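{- Let $n\ge 7$, $\rho$ and $N=\prod_p p^{\alpha_p}$ be as in the context, let $j$ be a positive integer, and let $\delta_1<\delta_2$ be two elements of $\mathcal{T}_j$ such that $\ell(\delta_2N)\le\ell(\delta_1N)$. Then $\delta_1\ne\pi^{(j)}(g(n))$.
   Context: For a positive integer $M=q_1^{\alpha_1}\cdots q_k^{\alpha_k}$ (standard factorization), $\ell(M)=q_1^{\alpha_1}+\dots+q_k^{\alpha_k}$, $\ell(1)=0$; $v_p$ is the $p$-adic valuation; $p_i$ is the $i$-th prime. $g(n)=\max\{M\ge1:\ell(M)\le n\}$. $\mathcal{E}=\{p/\log p\}\cup\{(p^{i+1}-p^i)/\log p: i\ge1\}$ ($p$ prime). An integer $N$ is an $\ell$-superchampion associated to $\rho>0$ if $\ell(M')-\rho\log M'\ge\ell(N)-\rho\log N$ for all $M'\ge1$; $N_\rho$, $N_\rho^+$ are the smallest and largest such. Fix $n\ge 7$, let $\rho$ be the element of $\mathcal{E}$ with $\rho\ge5/\log5$ and $\ell(N_\rho)\le n<\ell(N_\rho^+)$, and $N=N_\rho=\prod_p p^{\alpha_p}$. $\mathcal{T}_j$ is the set of rationals $\prod_{p\le p_j}p^{z_p}$ with integers $z_p\ge-\alpha_p$ (so $\delta N$ is a positive integer for $\delta\in\mathcal{T}_j$). For a positive integer $M$, its $j$-prefix is $\pi^{(j)}(M)=\prod_{p\le p_j}p^{v_p(M)-\alpha_p}$. -}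

module Defs where

open import Data.Nat using (ℕ; zero; suc; _+_; _*_; _∸_; _^_; _≤_; _<_; _≤?_)
open import Data.Nat.Properties using (m^n≢0)
open import Data.Nat.Divisibility using (_∣_; _∣?_)
open import Data.Nat.Primality using (Prime; prime?)
open import Data.Bool using (Bool; true; false; if_then_else_; _∧_; not)
open import Data.Nat.ListAction using (sum)
open import Data.List using (List; length; filter; map; foldr; upTo; applyUpTo)
open import Data.Integer as ℤ using (ℤ; +_; -[1+_]; 0ℤ; -_)
open import Data.Rational as ℚ using (ℚ; 1ℚ; ↥_)
open import Data.Product using (Σ; ∃; ∃-syntax; _×_)
open import Data.Sum using (_⊎_)
open import Relation.Nullary.Decidable using (⌊_⌋)
open import Relation.Binary.PropositionalEquality using (_≡_; _≢_)

-- p-adic valuation: v p m = #{ k ∈ [1..m] : p^k ∣ m }.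
-- For p ≥ 2 and m ≥ 1 the set of such k is an initial segment {1..v_p(m)}
-- (and v_p(m) < m), so this is exactly v_p(m).  (Only used for primes p.)
v : ℕ → ℕ → ℕ
v p m = length (filter (λ k → p ^ k ∣? m) (applyUpTo suc m))

ℓ : ℕ → ℕ
ℓ M = sum (map (λ q → if ⌊ prime? q ⌋ ∧ not ⌊ v q M Data.Nat.≟ 0 ⌋ then q ^ v q M else 0)
               (upTo (suc M)))

-- number of primes ≤ p;  for a prime p:  p ≤ p_j  ⇔  primeCount p ≤ j
primeCount : ℕ → ℕ
primeCount p = length (filter prime? (upTo (suc p)))

-- ρ ∈ ℰ is represented by a pair (q , c) with q prime and
-- ρ = c / log q, where c = q or c = q^(i+1) - q^i with i ≥ 1.
ENum : ℕ → ℕ → Set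
ENum q c = Prime q × (c ≡ q ⊎ ∃[ i ] (1 ≤ i × c ≡ q ^ suc i ∸ q ^ i))

-- ρ = c / log q ≥ 5 / log 5   ⇔   5^c ≥ q^5
ρ≥5/log5 : ℕ → ℕ → Set
ρ≥5/log5 q c = q ^ 5 ≤ 5 ^ c

-- N is an ℓ-superchampion for ρ = c / log q:
-- ∀ M' ≥ 1, ℓ(M') - ρ log M' ≥ ℓ(N) - ρ log N,
-- equivalently (exponentiating with base q):  q^{ℓ N} M'^c ≤ q^{ℓ M'} N^c.
IsSC : ℕ → ℕ → ℕ → Set
IsSC q c N = 1 ≤ N × (∀ M' → 1 ≤ M' → q ^ ℓ N * M' ^ c ≤ q ^ ℓ M' * N ^ c)

IsSmallestSC : ℕ → ℕ → ℕ → Set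
IsSmallestSC q c N = IsSC q c N × (∀ M → IsSC q c M → N ≤ M)

IsLargestSC : ℕ → ℕ → ℕ → Set
IsLargestSC q c N = IsSC q c N × (∀ M → IsSC q c M → M ≤ N)

IsG : ℕ → ℕ → Set
IsG n G = 1 ≤ G × ℓ G ≤ n × (∀ M → 1 ≤ M → ℓ M ≤ n → M ≤ G)

-- integer powers in ℚ (base 0 is never used)
zpow : ℕ → ℤ → ℚ
zpow zero     _        = 1ℚ
zpow (suc m) (+ k)     = (+ (suc m ^ k)) ℚ./ 1
zpow (suc m) -[1+ k ]  = (+ 1) ℚ./ (suc m ^ suc k) where instance _ = m^n≢0 (suc m) (suc k)

prodZ : (ℕ → ℤ) → ℕ → ℚ
prodZ z B = foldr (λ p acc → zpow p (z p) ℚ.* acc) 1ℚ (upTo (suc B))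

-- δ ∈ 𝒯_j (relative to N = ∏ p^{α_p}, α_p = v p N):
-- δ = ∏_{p ≤ p_j} p^{z_p} with integers z_p ≥ -α_p
-- (z is supported on primes p ≤ p_j; B bounds the support)
InT : ℕ → ℕ → ℚ → Set
InT j N δ = ∃[ z ] ∃[ B ]
  ( (∀ p → z p ≢ 0ℤ → Prime p × primeCount p ≤ j × p ≤ B)
  × (∀ p → Prime p → - (+ v p N) ℤ.≤ z p)
  × δ ≡ prodZ z B )

-- j-prefix π^{(j)}(M) = ∏_{p ≤ p_j} p^{v_p(M) - α_p}
-- (primes > M + N contribute exponent 0, so the product up to M + N suffices)
prefix : ℕ → ℕ → ℕ → ℚ
prefix j N M = prodZ (λ p → if ⌊ prime? p ⌋ ∧ ⌊ primeCount p ≤? j ⌋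
                             then (+ v p M) ℤ.- (+ v p N) else 0ℤ)
                     (M + N)

-- ℓ of a rational δN that is a positive integer: ℓ of its numerator
ℓℚ : ℚ → ℕ
ℓℚ x = ℓ ℤ.∣ ↥ x ∣

toℚ : ℕ → ℚ
toℚ N = (+ N) ℚ./ 1

{-# OPTIONS --safe #-}
module Submission where

-- Suppose δ₁ = π⁽ʲ⁾(G) for G = g(n), and put K₁ = δ₁N, K₂ = δ₂N; these are
-- positive integers with K₁ < K₂ and ℓ(K₂) ≤ ℓ(K₁).  At a prime p ≤ p_j the
-- exponent of K₁ is that of G, and at a prime p > p_j it is α_p, which is also
-- the exponent of K₂.  Hence M = K₂G/K₁ is an integer whose prime powers are
-- those of K₂ below p_j and those of G above, so ℓ(K₁) + ℓ(M) = ℓ(K₂) + ℓ(G)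
-- and ℓ(M) ≤ ℓ(G) ≤ n, while M > G: this contradicts the maximality of g(n).

open import Defs

-- The development is kept in an anonymous module so that ℕ's _*_, opened
-- here, does not clash with ℚ's _*_ in the statement of lemma8.
module _ where
  open import Data.Nat
  open import Data.Nat.Properties
  open import Data.Nat.Divisibility
  open import Data.Nat.Primality
  open import Data.Nat.Primality.Factorisation using (PrimeFactorisation; factorise)
  import Data.Nat.Coprimality as Coprime
  open import Data.Nat.ListAction using (sum; product)
  open import Data.Nat.ListAction.Properties using (sum-++)
  open import Data.List using (List; []; _∷_; [_]; _++_; _∷ʳ_; length; filter; applyUpTo; upTo; map; foldr)
  open import Data.List.Properties
    using ( upTo-∷ʳ; map-++; map-cong; applyUpTo-∷ʳ; length-++
          ; filter-++; filter-≐; filter-accept; filter-reject )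
  open import Data.List.Relation.Unary.All using (All; []; _∷_)
  open import Data.Product using (∃-syntax; _×_; _,_; proj₁; proj₂)
  open import Data.Sum using (_⊎_; inj₁; inj₂; [_,_]′)
  open import Data.Bool using (true; false; if_then_else_; _∧_; not)
  open import Data.Bool.Properties using (∧-zeroʳ)
  open import Data.Integer as ℤ using (ℤ; +_; -[1+_]; 0ℤ)
  import Data.Integer.Properties as ℤP
  open import Data.Rational as ℚ using (ℚ; 1ℚ; toℚᵘ)
  import Data.Rational.Properties as ℚP
  open import Data.Rational.Unnormalised as ℚᵘ using (ℚᵘ; mkℚᵘ; *≡*) renaming (_≃_ to _≃ᵘ_)
  import Data.Rational.Unnormalised.Properties as ℚᵘP
  open import Algebra.Properties.CommutativeSemigroup +-commutativeSemigroup
    using () renaming (interchange to +-interchange)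
  open import Algebra.Properties.CommutativeSemigroup *-commutativeSemigroup using (x∙yz≈y∙xz)
  open import Algebra.Properties.CommutativeSemigroup ℤP.+-commutativeSemigroup
    using () renaming (xy∙z≈xz∙y to ℤ-xy∙z≈xz∙y)
  open import Function using (_∘_; id)
  open import Relation.Nullary using (¬_; Dec; yes; no; contradiction)
  open import Relation.Nullary.Decidable using (⌊_⌋; decidable-stable)
  open import Relation.Binary.PropositionalEquality
    using (_≡_; _≢_; refl; sym; trans; cong; cong₂; subst; subst₂; module ≡-Reasoning)

  length-filter-≤? : ∀ k m → length (filter (_≤? k) (applyUpTo suc m)) ≡ k ⊓ m
  length-filter-≤? k zero = sym (⊓-zeroʳ k)
  length-filter-≤? k (suc m) = begin
    length (filter (_≤? k) (applyUpTo suc (suc m)))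
      ≡⟨ cong (length ∘ filter (_≤? k)) (sym (applyUpTo-∷ʳ suc m)) ⟩
    length (filter (_≤? k) (applyUpTo suc m ∷ʳ suc m))
      ≡⟨ cong length (filter-++ (_≤? k) (applyUpTo suc m) [ suc m ]) ⟩
    length (filter (_≤? k) (applyUpTo suc m) ++ filter (_≤? k) [ suc m ])
      ≡⟨ length-++ (filter (_≤? k) (applyUpTo suc m)) ⟩
    length (filter (_≤? k) (applyUpTo suc m)) + length (filter (_≤? k) [ suc m ])
      ≡⟨ cong (_+ length (filter (_≤? k) [ suc m ])) (length-filter-≤? k m) ⟩
    k ⊓ m + length (filter (_≤? k) [ suc m ])
      ≡⟨ last-step ⟩
    k ⊓ suc m ∎
    where
    open ≡-Reasoning
    last-step : k ⊓ m + length (filter (_≤? k) [ suc m ]) ≡ k ⊓ suc m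
    last-step with suc m ≤? k
    ... | yes m<k = begin
      k ⊓ m + length (filter (_≤? k) [ suc m ])
                  ≡⟨ cong (λ xs → k ⊓ m + length xs) (filter-accept (_≤? k) m<k) ⟩
      k ⊓ m + 1   ≡⟨ cong (_+ 1) (m≥n⇒m⊓n≡n (<⇒≤ m<k)) ⟩
      m + 1       ≡⟨ +-comm m 1 ⟩
      suc m       ≡⟨ sym (m≥n⇒m⊓n≡n m<k) ⟩
      k ⊓ suc m   ∎
    ... | no m≮k = begin
      k ⊓ m + length (filter (_≤? k) [ suc m ])
                  ≡⟨ cong (λ xs → k ⊓ m + length xs) (filter-reject (_≤? k) m≮k) ⟩
      k ⊓ m + 0   ≡⟨ +-identityʳ (k ⊓ m) ⟩
      k ⊓ m       ≡⟨ m≤n⇒m⊓n≡m k≤m ⟩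
      k           ≡⟨ sym (m≤n⇒m⊓n≡m (m≤n⇒m≤1+n k≤m)) ⟩
      k ⊓ suc m   ∎
      where
      k≤m : k ≤ m
      k≤m = ≤-pred (≰⇒> m≮k)

  n<m^n : ∀ {m} n → 1 < m → n < m ^ n
  n<m^n zero _ = s≤s z≤n
  n<m^n {suc zero} (suc _) (s≤s ())
  n<m^n {m@(suc (suc _))} (suc n) 1<m =
    ≤-trans (+-mono-≤ (m^n>0 m n) (≤-trans (n<m^n n 1<m) (≤-reflexive (sym (+-identityʳ (m ^ n))))))
            (*-monoˡ-≤ (m ^ n) 1<m)

  ^-monoʳ-∣ : ∀ p {i k} → i ≤ k → p ^ i ∣ p ^ k
  ^-monoʳ-∣ p {i} {k} i≤k = subst (p ^ i ∣_) pᵏ≡ (m∣m*n (p ^ (k ∸ i)))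
    where
    pᵏ≡ : p ^ i * p ^ (k ∸ i) ≡ p ^ k
    pᵏ≡ = trans (sym (^-distribˡ-+-* p i (k ∸ i))) (cong (p ^_) (m+[n∸m]≡n i≤k))

  prime>1 : ∀ {p} → Prime p → 1 < p
  prime>1 {p} pr = nonTrivial⇒n>1 p {{prime⇒nonTrivial pr}}

  v-unique : ∀ {p m k} → 1 < p → 0 < m → p ^ k ∣ m → ¬ p ^ suc k ∣ m → v p m ≡ k
  v-unique {p} {m} {k} 1<p 0<m pᵏ∣m ¬pᵏ⁺¹∣m = begin
    v p m                                      ≡⟨ cong length (filter-≐ (λ i → p ^ i ∣? m) (_≤? k)
                                                     (pⁱ∣m⇒i≤k , i≤k⇒pⁱ∣m) (applyUpTo suc m)) ⟩
    length (filter (_≤? k) (applyUpTo suc m))  ≡⟨ length-filter-≤? k m ⟩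
    k ⊓ m                                      ≡⟨ m≤n⇒m⊓n≡m k≤m ⟩
    k                                          ∎
    where
    open ≡-Reasoning
    instance
      m≢0 : NonZero m
      m≢0 = >-nonZero 0<m
    k≤m : k ≤ m
    k≤m = <⇒≤ (<-≤-trans (n<m^n k 1<p) (∣⇒≤ pᵏ∣m))
    pⁱ∣m⇒i≤k : ∀ {i} → p ^ i ∣ m → i ≤ k
    pⁱ∣m⇒i≤k pⁱ∣m = ≮⇒≥ (λ k<i → ¬pᵏ⁺¹∣m (∣-trans (^-monoʳ-∣ p k<i) pⁱ∣m))
    i≤k⇒pⁱ∣m : ∀ {i} → i ≤ k → p ^ i ∣ m
    i≤k⇒pⁱ∣m i≤k = ∣-trans (^-monoʳ-∣ p i≤k) pᵏ∣m

  maximal-power : ∀ {p m} i → ¬ p ^ i ∣ m → ∃[ k ] p ^ k ∣ m × ¬ p ^ suc k ∣ m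
  maximal-power {p} {m} zero ¬1∣m = contradiction (1∣ m) ¬1∣m
  maximal-power {p} {m} (suc i) ¬pⁱ⁺¹∣m with p ^ i ∣? m
  ... | yes pⁱ∣m = i , pⁱ∣m , ¬pⁱ⁺¹∣m
  ... | no ¬pⁱ∣m = maximal-power i ¬pⁱ∣m

  p^m∤m : ∀ {p m} → 1 < p → 0 < m → ¬ p ^ m ∣ m
  p^m∤m {p} {m} 1<p 0<m pᵐ∣m = <⇒≱ (n<m^n m 1<p) (∣⇒≤ {{>-nonZero 0<m}} pᵐ∣m)

  v-maximal : ∀ {p m} → 1 < p → 0 < m → p ^ v p m ∣ m × ¬ p ^ suc (v p m) ∣ m
  v-maximal {m = m} 1<p 0<m with maximal-power m (p^m∤m 1<p 0<m)
  ... | k , pᵏ∣m , ¬pᵏ⁺¹∣m rewrite v-unique {k = k} 1<p 0<m pᵏ∣m ¬pᵏ⁺¹∣m =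
    pᵏ∣m , ¬pᵏ⁺¹∣m

  v[p^k*m] : ∀ {p m} k → 1 < p → 0 < m → ¬ p ∣ m → v p (p ^ k * m) ≡ k
  v[p^k*m] {p} {m} k 1<p 0<m p∤m = v-unique {k = k} 1<p (*-mono-≤ (m^n>0 p k) 0<m) (m∣m*n m) ¬pᵏ⁺¹∣pᵏm
    where
    instance
      p≢0 : NonZero p
      p≢0 = >-nonZero (<-trans z<s 1<p)
    ¬pᵏ⁺¹∣pᵏm : ¬ p ^ suc k ∣ p ^ k * m
    ¬pᵏ⁺¹∣pᵏm d =
      p∤m (*-cancelˡ-∣ (p ^ k) {{m^n≢0 p k}} (subst (_∣ p ^ k * m) (*-comm p (p ^ k)) d))

  p-power-split : ∀ {p m} → 1 < p → 0 < m → ∃[ m′ ] m ≡ p ^ v p m * m′ × 0 < m′ × ¬ p ∣ m′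
  p-power-split {p} {m} 1<p 0<m = m′ , m≡ , 0<m′ , p∤m′
    where
    pᵛ∣m : p ^ v p m ∣ m
    pᵛ∣m = proj₁ (v-maximal 1<p 0<m)
    m′ : ℕ
    m′ = quotient pᵛ∣m
    m≡ : m ≡ p ^ v p m * m′
    m≡ = m∣n⇒n≡m*quotient pᵛ∣m
    0<m′ : 0 < m′
    0<m′ = >-nonZero⁻¹ m′ {{m*n≢0⇒n≢0 (p ^ v p m) {{subst NonZero m≡ (>-nonZero 0<m)}}}}
    p∤m′ : ¬ p ∣ m′
    p∤m′ p∣m′ = proj₂ (v-maximal 1<p 0<m)
      (subst₂ _∣_ (*-comm (p ^ v p m) p) (sym m≡) (*-monoʳ-∣ (p ^ v p m) p∣m′))

  v-* : ∀ {p a b} → Prime p → 0 < a → 0 < b → v p (a * b) ≡ v p a + v p b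
  v-* {p} {a} {b} pr 0<a 0<b with p-power-split (prime>1 pr) 0<a | p-power-split (prime>1 pr) 0<b
  ... | a′ , a≡ , 0<a′ , p∤a′ | b′ , b≡ , 0<b′ , p∤b′ = begin
    v p (a * b)
      ≡⟨ cong (v p) ab≡ ⟩
    v p (p ^ (v p a + v p b) * (a′ * b′))
      ≡⟨ v[p^k*m] (v p a + v p b) (prime>1 pr) (*-mono-≤ 0<a′ 0<b′) p∤a′b′ ⟩
    v p a + v p b
      ∎
    where
    open ≡-Reasoning
    ab≡ : a * b ≡ p ^ (v p a + v p b) * (a′ * b′)
    ab≡ = begin
      a * b
        ≡⟨ cong₂ _*_ a≡ b≡ ⟩
      (p ^ v p a * a′) * (p ^ v p b * b′)
        ≡⟨ [m*n]*[o*p]≡[m*o]*[n*p] (p ^ v p a) a′ (p ^ v p b) b′ ⟩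
      (p ^ v p a * p ^ v p b) * (a′ * b′)
        ≡⟨ cong (_* (a′ * b′)) (^-distribˡ-+-* p (v p a) (v p b)) ⟨
      p ^ (v p a + v p b) * (a′ * b′)
        ∎
    p∤a′b′ : ¬ p ∣ a′ * b′
    p∤a′b′ = [ p∤a′ , p∤b′ ]′ ∘ euclidsLemma a′ b′ pr

  v[p^k] : ∀ {p} k → 1 < p → v p (p ^ k) ≡ k
  v[p^k] {p} k 1<p = trans (cong (v p) (sym (*-identityʳ (p ^ k))))
                           (v[p^k*m] k 1<p z<s (λ p∣1 → <⇒≢ 1<p (sym (∣1⇒≡1 p∣1))))

  v-< : ∀ {p m} → 0 < m → m < p → v p m ≡ 0
  v-< {p} {m} 0<m m<p = trans (cong (v p) (sym (*-identityˡ m))) (v[p^k*m] 0 (≤-<-trans 0<m m<p) 0<m p∤m)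
    where
    p∤m : ¬ p ∣ m
    p∤m p∣m = <⇒≱ m<p (∣⇒≤ {{>-nonZero 0<m}} p∣m)

  v[1] : ∀ {p} → Prime p → v p 1 ≡ 0
  v[1] pr = v-< z<s (prime>1 pr)

  prime∣m^n⇒∣m : ∀ {p m} n → Prime p → p ∣ m ^ n → p ∣ m
  prime∣m^n⇒∣m zero pr p∣1 = contradiction (∣1⇒≡1 p∣1) (>⇒≢ (prime>1 pr))
  prime∣m^n⇒∣m {m = m} (suc n) pr p∣mᵐ⁺¹ =
    [ id , prime∣m^n⇒∣m n pr ]′ (euclidsLemma m (m ^ n) pr p∣mᵐ⁺¹)

  v[q^k] : ∀ {p q} k → Prime p → Prime q → p ≢ q → v p (q ^ k) ≡ 0
  v[q^k] {p} {q} k pp pq p≢q = trans (cong (v p) (sym (*-identityˡ (q ^ k))))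
    (v[p^k*m] 0 (prime>1 pp) (m^n>0 q {{prime⇒nonZero pq}} k) p∤qᵏ)
    where
    p∤qᵏ : ¬ p ∣ q ^ k
    p∤qᵏ p∣qᵏ = [ (λ p≡1 → >⇒≢ (prime>1 pp) p≡1) , p≢q ]′
                  (prime⇒irreducible pq (prime∣m^n⇒∣m k pp p∣qᵏ))

  v[p] : ∀ {p} → 1 < p → v p p ≡ 1
  v[p] {p} 1<p = trans (cong (v p) (sym (*-identityʳ p))) (v[p^k] 1 1<p)

  v>0⇒∣ : ∀ {p m} → 1 < p → 0 < m → 0 < v p m → p ∣ m
  v>0⇒∣ {p} {m} 1<p 0<m 0<v =
    ∣-trans (subst (_∣ p ^ v p m) (*-identityʳ p) (^-monoʳ-∣ p 0<v)) (proj₁ (v-maximal 1<p 0<m))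

  product-∣-by-v : ∀ {ps} → All Prime ps → ∀ {b} → 0 < b →
                   (∀ q → Prime q → v q (product ps) ≤ v q b) → product ps ∣ b
  product-∣-by-v [] {b} _ _ = 1∣ b
  product-∣-by-v {p ∷ ps} (pp ∷ pps) {b} 0<b v≤ =
    subst (p * product ps ∣_) (sym b≡) (*-monoʳ-∣ p (product-∣-by-v pps 0<b′ v≤′))
    where
    1<p : 1 < p
    1<p = prime>1 pp
    0<p : 0 < p
    0<p = <-trans z<s 1<p
    0<ps : 0 < product ps
    0<ps = productOfPrimes≥1 pps
    v[p*ps] : ∀ {q} → Prime q → v q (p * product ps) ≡ v q p + v q (product ps)
    v[p*ps] pq = v-* pq 0<p 0<ps
    p∣b : p ∣ b
    p∣b = v>0⇒∣ 1<p 0<b (≤-trans (≤-trans (≤-reflexive (sym (v[p] 1<p))) (m≤m+n (v p p) _))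
                                    (subst (_≤ v p b) (v[p*ps] pp) (v≤ p pp)))
    b′ : ℕ
    b′ = quotient p∣b
    b≡ : b ≡ p * b′
    b≡ = m∣n⇒n≡m*quotient p∣b
    0<b′ : 0 < b′
    0<b′ = >-nonZero⁻¹ b′ {{m*n≢0⇒n≢0 p {{subst NonZero b≡ (>-nonZero 0<b)}}}}
    v≤′ : ∀ q → Prime q → v q (product ps) ≤ v q b′
    v≤′ q pq = +-cancelˡ-≤ (v q p) _ _
      (subst₂ _≤_ (v[p*ps] pq) (trans (cong (v q) b≡) (v-* pq 0<p 0<b′)) (v≤ q pq))

  v-≤⇒∣ : ∀ {a b} → 0 < a → 0 < b → (∀ p → Prime p → v p a ≤ v p b) → a ∣ b
  v-≤⇒∣ {a} {b} 0<a 0<b v≤ =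
    subst (_∣ b) (sym a≡)
      (product-∣-by-v factorsPrime 0<b (subst (λ x → ∀ p → Prime p → v p x ≤ v p b) a≡ v≤))
    where
    F : PrimeFactorisation a
    F = factorise a {{>-nonZero 0<a}}
    open PrimeFactorisation F
    a≡ : a ≡ product factors
    a≡ = isFactorisation

  sumTo : (ℕ → ℕ) → ℕ → ℕ
  sumTo f B = sum (map f (upTo (suc B)))

  sumTo-suc : ∀ f B → sumTo f (suc B) ≡ sumTo f B + f (suc B)
  sumTo-suc f B = begin
    sum (map f (upTo (suc (suc B))))              ≡⟨ cong (sum ∘ map f) (sym (upTo-∷ʳ (suc B))) ⟩
    sum (map f (upTo (suc B) ++ [ suc B ]))       ≡⟨ cong sum (map-++ f (upTo (suc B)) [ suc B ]) ⟩
    sum (map f (upTo (suc B)) ++ [ f (suc B) ])   ≡⟨ sum-++ (map f (upTo (suc B))) [ f (suc B) ] ⟩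
    sumTo f B + (f (suc B) + 0)                   ≡⟨ cong (λ y → sumTo f B + y) (+-identityʳ (f (suc B))) ⟩
    sumTo f B + f (suc B)                         ∎
    where open ≡-Reasoning

  sumTo-cong : ∀ {f g} B → (∀ q → f q ≡ g q) → sumTo f B ≡ sumTo g B
  sumTo-cong B f≗g = cong sum (map-cong f≗g (upTo (suc B)))

  sum-map-+ : ∀ {a} {A : Set a} (f g : A → ℕ) xs →
              sum (map f xs) + sum (map g xs) ≡ sum (map (λ q → f q + g q) xs)
  sum-map-+ f g [] = refl
  sum-map-+ f g (x ∷ xs) = begin
    (f x + sum (map f xs)) + (g x + sum (map g xs))  ≡⟨ +-interchange (f x) (sum (map f xs)) (g x) _ ⟩
    (f x + g x) + (sum (map f xs) + sum (map g xs))  ≡⟨ cong (λ y → f x + g x + y) (sum-map-+ f g xs) ⟩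
    (f x + g x) + sum (map (λ q → f q + g q) xs)     ∎
    where open ≡-Reasoning

  sumTo-+ : ∀ f g B → sumTo f B + sumTo g B ≡ sumTo (λ q → f q + g q) B
  sumTo-+ f g B = sum-map-+ f g (upTo (suc B))

  sumTo-vanishing : ∀ f {M B} → (∀ q → M < q → f q ≡ 0) → M ≤ B → sumTo f B ≡ sumTo f M
  sumTo-vanishing f {M} {B} f≡0 M≤B =
    subst (λ B → sumTo f B ≡ sumTo f M) (m+[n∸m]≡n M≤B) (go (B ∸ M))
    where
    go : ∀ d → sumTo f (M + d) ≡ sumTo f M
    go zero = cong (sumTo f) (+-identityʳ M)
    go (suc d) = begin
      sumTo f (M + suc d)                 ≡⟨ cong (sumTo f) (+-suc M d) ⟩
      sumTo f (suc (M + d))               ≡⟨ sumTo-suc f (M + d) ⟩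
      sumTo f (M + d) + f (suc (M + d))   ≡⟨ cong₂ _+_ (go d) (f≡0 (suc (M + d)) (s≤s (m≤m+n M d))) ⟩
      sumTo f M + 0                       ≡⟨ +-identityʳ (sumTo f M) ⟩
      sumTo f M                           ∎
      where open ≡-Reasoning

  sumTo-below : ∀ f {p} B → (∀ q → q ≢ p → f q ≡ 0) → B < p → sumTo f B ≡ 0
  sumTo-below f zero f≡0 0<p = trans (+-identityʳ (f 0)) (f≡0 0 (<⇒≢ 0<p))
  sumTo-below f (suc B) f≡0 B+1<p = begin
    sumTo f (suc B)        ≡⟨ sumTo-suc f B ⟩
    sumTo f B + f (suc B)  ≡⟨ cong₂ _+_ (sumTo-below f B f≡0 (<-trans (n<1+n B) B+1<p))
                                       (f≡0 (suc B) (<⇒≢ B+1<p)) ⟩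
    0                      ∎
    where open ≡-Reasoning

  sumTo-at : ∀ f p → (∀ q → q ≢ p → f q ≡ 0) → sumTo f p ≡ f p
  sumTo-at f zero _ = +-identityʳ (f 0)
  sumTo-at f (suc p) f≡0 = trans (sumTo-suc f p) (cong (_+ f (suc p)) (sumTo-below f p f≡0 (n<1+n p)))

  sumTo-single : ∀ f p B → (∀ q → q ≢ p → f q ≡ 0) → (B < p → f p ≡ 0) → sumTo f B ≡ f p
  sumTo-single f p B f≡0 fp≡0 with p ≤? B
  ... | no p≰B = trans (sumTo-below f B f≡0 (≰⇒> p≰B)) (sym (fp≡0 (≰⇒> p≰B)))
  ... | yes p≤B = trans (sumTo-vanishing f (λ q p<q → f≡0 q (>⇒≢ p<q)) p≤B) (sumTo-at f p f≡0)

  ℓ-term : ℕ → ℕ → ℕ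
  ℓ-term q e = if ⌊ prime? q ⌋ ∧ not ⌊ e ≟ 0 ⌋ then q ^ e else 0

  ℓ-term-zero : ∀ q → ℓ-term q 0 ≡ 0
  ℓ-term-zero q rewrite ∧-zeroʳ ⌊ prime? q ⌋ = refl

  ℓ-term-nonprime : ∀ {q} → ¬ Prime q → ∀ e → ℓ-term q e ≡ 0
  ℓ-term-nonprime {q} ¬pq e with prime? q
  ... | yes pq = contradiction pq ¬pq
  ... | no _ = refl

  ℓ-sumTo : ∀ {M B} → 0 < M → M ≤ B → ℓ M ≡ sumTo (λ q → ℓ-term q (v q M)) B
  ℓ-sumTo {M} 0<M M≤B = sym (sumTo-vanishing (λ q → ℓ-term q (v q M)) vanish M≤B)
    where
    vanish : ∀ q → M < q → ℓ-term q (v q M) ≡ 0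
    vanish q M<q = trans (cong (ℓ-term q) (v-< 0<M M<q)) (ℓ-term-zero q)

  SameValuationPairs : ℕ → ℕ → ℕ → ℕ → Set
  SameValuationPairs a b c d =
    ∀ p → Prime p → (v p a ≡ v p c × v p b ≡ v p d) ⊎ (v p a ≡ v p d × v p b ≡ v p c)

  ℓ+ℓ≡ℓ+ℓ : ∀ {a b c d} → 0 < a → 0 < b → 0 < c → 0 < d →
            SameValuationPairs a b c d → ℓ a + ℓ b ≡ ℓ c + ℓ d
  ℓ+ℓ≡ℓ+ℓ {a} {b} {c} {d} 0<a 0<b 0<c 0<d same = begin
    ℓ a + ℓ b                            ≡⟨ cong₂ _+_ (ℓ-sumTo 0<a a≤T) (ℓ-sumTo 0<b b≤T) ⟩
    sumTo (part a) T + sumTo (part b) T  ≡⟨ sumTo-+ (part a) (part b) T ⟩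
    sumTo (part a +′ part b) T           ≡⟨ sumTo-cong T pointwise ⟩
    sumTo (part c +′ part d) T           ≡⟨ sumTo-+ (part c) (part d) T ⟨
    sumTo (part c) T + sumTo (part d) T  ≡⟨ cong₂ _+_ (ℓ-sumTo 0<c c≤T) (ℓ-sumTo 0<d d≤T) ⟨
    ℓ c + ℓ d                            ∎
    where
    open ≡-Reasoning
    part : ℕ → ℕ → ℕ
    part m q = ℓ-term q (v q m)
    _+′_ : (ℕ → ℕ) → (ℕ → ℕ) → ℕ → ℕ
    (f +′ g) q = f q + g q
    T : ℕ
    T = a + b + c + d
    a≤T : a ≤ T
    a≤T = ≤-trans (m≤m+n a b) (≤-trans (m≤m+n (a + b) c) (m≤m+n (a + b + c) d))
    b≤T : b ≤ T
    b≤T = ≤-trans (m≤n+m b a) (≤-trans (m≤m+n (a + b) c) (m≤m+n (a + b + c) d))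
    c≤T : c ≤ T
    c≤T = ≤-trans (m≤n+m c (a + b)) (m≤m+n (a + b + c) d)
    d≤T : d ≤ T
    d≤T = m≤n+m d (a + b + c)
    pointwise : ∀ q → part a q + part b q ≡ part c q + part d q
    pointwise q = by-primality (prime? q)
      where
      by-primality : Dec (Prime q) → part a q + part b q ≡ part c q + part d q
      by-primality (no ¬pq) = trans (cong₂ _+_ (ℓ-term-nonprime ¬pq _) (ℓ-term-nonprime ¬pq _))
                                    (sym (cong₂ _+_ (ℓ-term-nonprime ¬pq _) (ℓ-term-nonprime ¬pq _)))
      by-primality (yes pq) with same q pq
      ... | inj₁ (a≡c , b≡d) = cong₂ _+_ (cong (ℓ-term q) a≡c) (cong (ℓ-term q) b≡d)
      ... | inj₂ (a≡d , b≡c) = trans (cong₂ _+_ (cong (ℓ-term q) a≡d) (cong (ℓ-term q) b≡c))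
                                     (+-comm (part d q) (part c q))

  -- zpow x k = pow⁺ x k / pow⁻ x k, with zpow's convention for the base 0.
  pow⁺ pow⁻ : ℕ → ℤ → ℕ
  pow⁺ zero    _        = 1
  pow⁺ (suc m) (+ k)    = suc m ^ k
  pow⁺ (suc m) -[1+ k ] = 1
  pow⁻ zero    _        = 1
  pow⁻ (suc m) (+ k)    = 1
  pow⁻ (suc m) -[1+ k ] = suc m ^ suc k

  pow⁺>0 : ∀ x k → 0 < pow⁺ x k
  pow⁺>0 zero    _        = z<s
  pow⁺>0 (suc m) (+ k)    = m^n>0 (suc m) k
  pow⁺>0 (suc m) -[1+ k ] = z<s

  pow⁻>0 : ∀ x k → 0 < pow⁻ x k
  pow⁻>0 zero    _        = z<s
  pow⁻>0 (suc m) (+ k)    = z<s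
  pow⁻>0 (suc m) -[1+ k ] = m^n>0 (suc m) (suc k)

  v-pow⁺-pow⁻ : ∀ {p} k → Prime p → + v p (pow⁺ p k) ≡ + v p (pow⁻ p k) ℤ.+ k
  v-pow⁺-pow⁻ {suc m} (+ k) pp rewrite v[p^k] k (prime>1 pp) | v[1] pp = refl
  v-pow⁺-pow⁻ {suc m} -[1+ k ] pp rewrite v[p^k] (suc k) (prime>1 pp) | v[1] pp = sym (ℤP.n⊖n≡0 (suc k))

  v-pow⁻≤ : ∀ {p n} k → Prime p → ℤ.- (+ n) ℤ.≤ k → v p (pow⁻ p k) ≤ n
  v-pow⁻≤ {suc m} (+ k) pp _ rewrite v[1] pp = z≤n
  v-pow⁻≤ {suc m} {zero} -[1+ k ] pp ()
  v-pow⁻≤ {suc m} {suc n} -[1+ k ] pp (ℤ.-≤- k≤n) rewrite v[p^k] (suc k) (prime>1 pp) = s≤s k≤n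

  v-pow⁺-off : ∀ {p} x k → Prime p → (k ≢ 0ℤ → Prime x × x ≢ p) → v p (pow⁺ x k) ≡ 0
  v-pow⁺-off zero    _           pp _   = v[1] pp
  v-pow⁺-off (suc m) (+ zero)    pp _   = v[1] pp
  v-pow⁺-off (suc m) (+ suc k)   pp off = v[q^k] (suc k) pp (proj₁ (off λ ())) (proj₂ (off λ ()) ∘ sym)
  v-pow⁺-off (suc m) -[1+ k ]    pp _   = v[1] pp

  v-pow⁻-off : ∀ {p} x k → Prime p → (k ≢ 0ℤ → Prime x × x ≢ p) → v p (pow⁻ x k) ≡ 0
  v-pow⁻-off zero    _        pp _   = v[1] pp
  v-pow⁻-off (suc m) (+ k)    pp _   = v[1] pp
  v-pow⁻-off (suc m) -[1+ k ] pp off = v[q^k] (suc k) pp (proj₁ (off λ ())) (proj₂ (off λ ()) ∘ sym)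

  -- Meant for b > 0; a denominator 0 is read as 1.
  _/ᵘ_ : ℕ → ℕ → ℚᵘ
  a /ᵘ b = mkℚᵘ (+ a) (pred b)

  toℚᵘ-/ : ∀ i n .{{_ : NonZero n}} → toℚᵘ (i ℚ./ n) ≃ᵘ mkℚᵘ i (pred n)
  toℚᵘ-/ i (suc n) = ℚP.toℚᵘ-fromℚᵘ (mkℚᵘ i n)

  /ᵘ-* : ∀ a {b} c {d} → 0 < b → 0 < d → (a /ᵘ b) ℚᵘ.* (c /ᵘ d) ≃ᵘ (a * c) /ᵘ (b * d)
  /ᵘ-* a {suc b} c {suc d} _ _ = *≡* (cong (ℤ._* (+ suc (d + b * suc d))) (sym (ℤP.pos-* a c)))

  /ᵘ-≃ : ∀ a {b} c {d} → 0 < b → 0 < d → a * d ≡ c * b → a /ᵘ b ≃ᵘ c /ᵘ d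
  /ᵘ-≃ a {suc b} c {suc d} _ _ ad≡cb =
    *≡* (trans (sym (ℤP.pos-* a (suc d))) (trans (cong +_ ad≡cb) (ℤP.pos-* c (suc b))))

  zpow≃ : ∀ x k → toℚᵘ (zpow x k) ≃ᵘ pow⁺ x k /ᵘ pow⁻ x k
  zpow≃ zero    _        = ℚᵘP.≃-refl
  zpow≃ (suc m) (+ k)    = toℚᵘ-/ (+ (suc m ^ k)) 1
  zpow≃ (suc m) -[1+ k ] = toℚᵘ-/ (+ 1) (suc m ^ suc k) {{m^n≢0 (suc m) (suc k)}}

  product-map>0 : ∀ {a} {A : Set a} (g : A → ℕ) → (∀ x → 0 < g x) → ∀ xs → 0 < product (map g xs)
  product-map>0 g g>0 []       = z<s
  product-map>0 g g>0 (x ∷ xs) = *-mono-≤ (g>0 x) (product-map>0 g g>0 xs)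

  ∏⁺ ∏⁻ : (ℕ → ℤ) → List ℕ → ℕ
  ∏⁺ z xs = product (map (λ x → pow⁺ x (z x)) xs)
  ∏⁻ z xs = product (map (λ x → pow⁻ x (z x)) xs)

  ∏⁺>0 : ∀ z xs → 0 < ∏⁺ z xs
  ∏⁺>0 z = product-map>0 _ (λ x → pow⁺>0 x (z x))

  ∏⁻>0 : ∀ z xs → 0 < ∏⁻ z xs
  ∏⁻>0 z = product-map>0 _ (λ x → pow⁻>0 x (z x))

  foldr-zpow≃ : ∀ z xs →
                toℚᵘ (foldr (λ p acc → zpow p (z p) ℚ.* acc) 1ℚ xs) ≃ᵘ ∏⁺ z xs /ᵘ ∏⁻ z xs
  foldr-zpow≃ z []       = ℚᵘP.≃-refl
  foldr-zpow≃ z (x ∷ xs) = begin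
    toℚᵘ (zpow x (z x) ℚ.* rest)
      ≈⟨ ℚP.toℚᵘ-homo-* (zpow x (z x)) rest ⟩
    toℚᵘ (zpow x (z x)) ℚᵘ.* toℚᵘ rest
      ≈⟨ ℚᵘP.*-cong (zpow≃ x (z x)) (foldr-zpow≃ z xs) ⟩
    (pow⁺ x (z x) /ᵘ pow⁻ x (z x)) ℚᵘ.* (∏⁺ z xs /ᵘ ∏⁻ z xs)
      ≈⟨ /ᵘ-* (pow⁺ x (z x)) (∏⁺ z xs) (pow⁻>0 x (z x)) (∏⁻>0 z xs) ⟩
    ∏⁺ z (x ∷ xs) /ᵘ ∏⁻ z (x ∷ xs)
      ∎
    where
    open ℚᵘP.≃-Reasoning
    rest : ℚ
    rest = foldr (λ p acc → zpow p (z p) ℚ.* acc) 1ℚ xs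

  v-product-map : ∀ {a} {A : Set a} {p} → Prime p → (g : A → ℕ) → (∀ x → 0 < g x) →
                  ∀ xs → v p (product (map g xs)) ≡ sum (map (v p ∘ g) xs)
  v-product-map pp g g>0 []       = v[1] pp
  v-product-map {p = p} pp g g>0 (x ∷ xs) =
    trans (v-* pp (g>0 x) (product-map>0 g g>0 xs)) (cong (λ y → v p (g x) + y) (v-product-map pp g g>0 xs))

  prodZ-*-multiple : ∀ z B t →
                     prodZ z B ℚ.* toℚ (∏⁻ z (upTo (suc B)) * t) ≡ toℚ (∏⁺ z (upTo (suc B)) * t)
  prodZ-*-multiple z B t = trans (sym (ℚP.fromℚᵘ-toℚᵘ _)) (ℚP.fromℚᵘ-cong ≃num*t)
    where
    num den : ℕ
    num = ∏⁺ z (upTo (suc B))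
    den = ∏⁻ z (upTo (suc B))
    0<den : 0 < den
    0<den = ∏⁻>0 z (upTo (suc B))
    cross : num * (den * t) * 1 ≡ num * t * (den * 1)
    cross = begin
      num * (den * t) * 1   ≡⟨ *-identityʳ (num * (den * t)) ⟩
      num * (den * t)       ≡⟨ x∙yz≈y∙xz num den t ⟩
      den * (num * t)       ≡⟨ *-comm den (num * t) ⟩
      num * t * den         ≡⟨ cong (num * t *_) (*-identityʳ den) ⟨
      num * t * (den * 1)   ∎
      where open ≡-Reasoning
    ≃num*t : toℚᵘ (prodZ z B ℚ.* toℚ (den * t)) ≃ᵘ (num * t) /ᵘ 1
    ≃num*t = begin
      toℚᵘ (prodZ z B ℚ.* toℚ (den * t))
        ≈⟨ ℚP.toℚᵘ-homo-* (prodZ z B) (toℚ (den * t)) ⟩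
      toℚᵘ (prodZ z B) ℚᵘ.* toℚᵘ (toℚ (den * t))
        ≈⟨ ℚᵘP.*-cong (foldr-zpow≃ z (upTo (suc B))) (toℚᵘ-/ (+ (den * t)) 1) ⟩
      (num /ᵘ den) ℚᵘ.* ((den * t) /ᵘ 1)
        ≈⟨ /ᵘ-* num (den * t) 0<den z<s ⟩
      (num * (den * t)) /ᵘ (den * 1)
        ≈⟨ /ᵘ-≃ (num * (den * t)) (num * t) (*-mono-≤ 0<den z<s) z<s cross ⟩
      (num * t) /ᵘ 1
        ∎
      where open ℚᵘP.≃-Reasoning

  record IntegralMultiple (δ : ℚ) (N : ℕ) (z : ℕ → ℤ) : Set where
    field
      value    : ℕ
      value>0  : 0 < value
      δN≡value : δ ℚ.* toℚ N ≡ toℚ value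
      v-value  : ∀ p → Prime p → + v p value ≡ + v p N ℤ.+ z p

  -- The exponent vectors of 𝒯_j, with the condition p ≤ p_j weakened to p ≤ B.
  record Admissible (N B : ℕ) (z : ℕ → ℤ) : Set where
    field
      support-prime : ∀ q → z q ≢ 0ℤ → Prime q
      support-≤     : ∀ q → B < q → z q ≡ 0ℤ
      ≥-v           : ∀ q → Prime q → ℤ.- (+ v q N) ℤ.≤ z q

  module _ {N B : ℕ} {z : ℕ → ℤ} (adm : Admissible N B z) where
    open Admissible adm

    v-∏⁺ : ∀ {p} → Prime p → v p (∏⁺ z (upTo (suc B))) ≡ v p (pow⁺ p (z p))
    v-∏⁺ {p} pp = trans (v-product-map pp _ (λ x → pow⁺>0 x (z x)) (upTo (suc B)))
      (sumTo-single (λ x → v p (pow⁺ x (z x))) p B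
        (λ x x≢p → v-pow⁺-off x (z x) pp (λ zx≢0 → support-prime x zx≢0 , x≢p))
        (λ B<p → v-pow⁺-off p (z p) pp (λ zp≢0 → contradiction (support-≤ p B<p) zp≢0)))

    v-∏⁻ : ∀ {p} → Prime p → v p (∏⁻ z (upTo (suc B))) ≡ v p (pow⁻ p (z p))
    v-∏⁻ {p} pp = trans (v-product-map pp _ (λ x → pow⁻>0 x (z x)) (upTo (suc B)))
      (sumTo-single (λ x → v p (pow⁻ x (z x))) p B
        (λ x x≢p → v-pow⁻-off x (z x) pp (λ zx≢0 → support-prime x zx≢0 , x≢p))
        (λ B<p → v-pow⁻-off p (z p) pp (λ zp≢0 → contradiction (support-≤ p B<p) zp≢0)))

    prodZ*N-integral : 0 < N → IntegralMultiple (prodZ z B) N z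
    prodZ*N-integral 0<N = record
      { value = K ; value>0 = 0<K ; δN≡value = prodZ*N≡K ; v-value = v[K] }
      where
      num den : ℕ
      num = ∏⁺ z (upTo (suc B))
      den = ∏⁻ z (upTo (suc B))
      0<num : 0 < num
      0<num = ∏⁺>0 z (upTo (suc B))
      0<den : 0 < den
      0<den = ∏⁻>0 z (upTo (suc B))
      den∣N : den ∣ N
      den∣N = v-≤⇒∣ 0<den 0<N λ p pp →
        subst (_≤ v p N) (sym (v-∏⁻ pp)) (v-pow⁻≤ (z p) pp (≥-v p pp))
      t : ℕ
      t = quotient den∣N
      N≡ : N ≡ den * t
      N≡ = m∣n⇒n≡m*quotient den∣N
      0<t : 0 < t
      0<t = >-nonZero⁻¹ t {{m*n≢0⇒n≢0 den {{subst NonZero N≡ (>-nonZero 0<N)}}}}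
      K : ℕ
      K = num * t
      0<K : 0 < K
      0<K = *-mono-≤ 0<num 0<t
      prodZ*N≡K : prodZ z B ℚ.* toℚ N ≡ toℚ K
      prodZ*N≡K = trans (cong (λ m → prodZ z B ℚ.* toℚ m) N≡) (prodZ-*-multiple z B t)
      v[num] : ∀ {p} → Prime p → + v p num ≡ + v p den ℤ.+ z p
      v[num] {p} pp = begin
        + v p num                     ≡⟨ cong +_ (v-∏⁺ pp) ⟩
        + v p (pow⁺ p (z p))          ≡⟨ v-pow⁺-pow⁻ (z p) pp ⟩
        + v p (pow⁻ p (z p)) ℤ.+ z p  ≡⟨ cong (λ n → + n ℤ.+ z p) (v-∏⁻ pp) ⟨
        + v p den ℤ.+ z p             ∎
        where open ≡-Reasoning
      v[K] : ∀ p → Prime p → + v p K ≡ + v p N ℤ.+ z p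
      v[K] p pp = begin
        + v p K                           ≡⟨ cong +_ (v-* pp 0<num 0<t) ⟩
        + v p num ℤ.+ + v p t             ≡⟨ cong (ℤ._+ + v p t) (v[num] pp) ⟩
        (+ v p den ℤ.+ z p) ℤ.+ + v p t   ≡⟨ ℤ-xy∙z≈xz∙y (+ v p den) (z p) (+ v p t) ⟩
        (+ v p den ℤ.+ + v p t) ℤ.+ z p   ≡⟨ cong (λ n → + n ℤ.+ z p) v[N] ⟨
        + v p N ℤ.+ z p                   ∎
        where
        open ≡-Reasoning
        v[N] : v p N ≡ v p den + v p t
        v[N] = trans (cong (v p) N≡) (v-* pp 0<den 0<t)

  toℚ≡mkℚ : ∀ K → toℚ K ≡ ℚ.mkℚ (+ K) 0 (Coprime.sym (Coprime.1-coprimeTo K))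
  toℚ≡mkℚ K = ℚP.normalize-coprime (Coprime.sym (Coprime.1-coprimeTo K))

  ℓℚ-toℚ : ∀ K → ℓℚ (toℚ K) ≡ ℓ K
  ℓℚ-toℚ K = cong (λ x → ℓ ℤ.∣ ℚ.↥ x ∣) (toℚ≡mkℚ K)

  toℚ-cancel-< : ∀ {a b} → toℚ a ℚ.< toℚ b → a < b
  toℚ-cancel-< {a} {b} a<b = ℤP.drop‿+<+ (subst₂ ℤ._<_ (ℤP.*-identityʳ (+ a)) (ℤP.*-identityʳ (+ b))
    (ℚP.drop-*<* (subst₂ ℚ._<_ (toℚ≡mkℚ a) (toℚ≡mkℚ b) a<b)))

  toℚ>0 : ∀ {N} → 0 < N → ℚ.Positive (toℚ N)
  toℚ>0 {suc N} _ = ℚP.normalize-pos (suc N) 1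

  exchange-improves : ∀ {G K₁ K₂} → 0 < G → 0 < K₁ → 0 < K₂ → K₁ < K₂ → ℓ K₂ ≤ ℓ K₁ →
                      (∀ p → Prime p → v p K₁ ≡ v p G ⊎ v p K₁ ≡ v p K₂) →
                      ∃[ M ] 0 < M × G < M × ℓ M ≤ ℓ G
  exchange-improves {G} {K₁} {K₂} 0<G 0<K₁ 0<K₂ K₁<K₂ ℓK₂≤ℓK₁ v[K₁] =
    improve (v-≤⇒∣ 0<K₁ (*-mono-≤ 0<K₂ 0<G) v[K₁]≤)
    where
    v[K₁]≤ : ∀ p → Prime p → v p K₁ ≤ v p (K₂ * G)
    v[K₁]≤ p pp = subst (v p K₁ ≤_) (sym (v-* pp 0<K₂ 0<G))
      ([ (λ e → ≤-trans (≤-reflexive e) (m≤n+m (v p G) (v p K₂)))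
       , (λ e → ≤-trans (≤-reflexive e) (m≤m+n (v p K₂) (v p G))) ]′ (v[K₁] p pp))
    improve : K₁ ∣ K₂ * G → ∃[ M ] 0 < M × G < M × ℓ M ≤ ℓ G
    improve (divides M K₂G≡MK₁) = M , 0<M , G<M , ℓM≤ℓG
      where
      K₂G≡K₁M : K₂ * G ≡ K₁ * M
      K₂G≡K₁M = trans K₂G≡MK₁ (*-comm M K₁)
      0<M : 0 < M
      0<M = >-nonZero⁻¹ M
        {{m*n≢0⇒n≢0 K₁ {{subst NonZero K₂G≡K₁M (>-nonZero (*-mono-≤ 0<K₂ 0<G))}}}}
      v[K₁M] : ∀ p → Prime p → v p K₁ + v p M ≡ v p K₂ + v p G
      v[K₁M] p pp = trans (sym (v-* pp 0<K₁ 0<M)) (trans (cong (v p) (sym K₂G≡K₁M)) (v-* pp 0<K₂ 0<G))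
      same : SameValuationPairs K₁ M K₂ G
      same p pp with v[K₁] p pp
      ... | inj₁ K₁≡G = inj₂ (K₁≡G , +-cancelʳ-≡ (v p G) (v p M) (v p K₂)
              (trans (+-comm (v p M) (v p G)) (trans (cong (_+ v p M) (sym K₁≡G)) (v[K₁M] p pp))))
      ... | inj₂ K₁≡K₂ = inj₁ (K₁≡K₂ , +-cancelˡ-≡ (v p K₂) (v p M) (v p G)
              (trans (cong (_+ v p M) (sym K₁≡K₂)) (v[K₁M] p pp)))
      ℓM≤ℓG : ℓ M ≤ ℓ G
      ℓM≤ℓG = +-cancelˡ-≤ (ℓ K₁) (ℓ M) (ℓ G)
        (subst (_≤ ℓ K₁ + ℓ G) (sym (ℓ+ℓ≡ℓ+ℓ 0<K₁ 0<M 0<K₂ 0<G same)) (+-monoˡ-≤ (ℓ G) ℓK₂≤ℓK₁))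
      G<M : G < M
      G<M = *-cancelˡ-< K₁ G M (subst (K₁ * G <_) K₂G≡K₁M (*-monoˡ-< G {{>-nonZero 0<G}} K₁<K₂))

  IsSmall : ℕ → ℕ → Set
  IsSmall j p = Prime p × primeCount p ≤ j

  onSmall : ℕ → ℕ → ℤ → ℤ
  onSmall j p a = if ⌊ prime? p ⌋ ∧ ⌊ primeCount p ≤? j ⌋ then a else 0ℤ

  onSmall-small : ∀ {j p} a → IsSmall j p → onSmall j p a ≡ a
  onSmall-small {j} {p} a (pp , p≤j) with prime? p | primeCount p ≤? j
  ... | yes _ | yes _  = refl
  ... | no ¬pp | _     = contradiction pp ¬pp
  ... | yes _ | no p≰j = contradiction p≤j p≰j

  onSmall-large : ∀ {j p} a → ¬ IsSmall j p → onSmall j p a ≡ 0ℤ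
  onSmall-large {j} {p} a ¬small with prime? p | primeCount p ≤? j
  ... | yes pp | yes p≤j = contradiction (pp , p≤j) ¬small
  ... | no _   | _       = refl
  ... | yes _  | no _    = refl

  onSmall-support : ∀ {j p} a → onSmall j p a ≢ 0ℤ → IsSmall j p
  onSmall-support {j} {p} a a≢0 with prime? p | primeCount p ≤? j
  ... | yes pp | yes p≤j = pp , p≤j
  ... | no _   | _       = contradiction refl a≢0
  ... | yes _  | no _    = contradiction refl a≢0

  onSmall-0 : ∀ j p → onSmall j p 0ℤ ≡ 0ℤ
  onSmall-0 j p with ⌊ prime? p ⌋ ∧ ⌊ primeCount p ≤? j ⌋
  ... | true  = refl
  ... | false = refl

  onSmall-≥ : ∀ j p {b} a → b ℤ.≤ a → b ℤ.≤ 0ℤ → b ℤ.≤ onSmall j p a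
  onSmall-≥ j p a b≤a b≤0 with ⌊ prime? p ⌋ ∧ ⌊ primeCount p ≤? j ⌋
  ... | true  = b≤a
  ... | false = b≤0

  prefixExponent : ℕ → ℕ → ℕ → ℕ → ℤ
  prefixExponent j N M p = onSmall j p ((+ v p M) ℤ.- (+ v p N))

  prefixExponent-admissible : ∀ {j N M} → 0 < N → 0 < M → Admissible N (M + N) (prefixExponent j N M)
  prefixExponent-admissible {j} {N} {M} 0<N 0<M = record
    { support-prime = λ p e≢0 → proj₁ (onSmall-support _ e≢0)
    ; support-≤     = vanishes
    ; ≥-v           = bounded
    }
    where
    vanishes : ∀ p → M + N < p → prefixExponent j N M p ≡ 0ℤ
    vanishes p M+N<p = begin
      onSmall j p (+ v p M ℤ.- + v p N)
        ≡⟨ cong (λ e → onSmall j p (+ e ℤ.- + v p N)) (v-< 0<M (≤-<-trans (m≤m+n M N) M+N<p)) ⟩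
      onSmall j p (+ 0 ℤ.- + v p N)
        ≡⟨ cong (λ e → onSmall j p (+ 0 ℤ.- + e)) (v-< 0<N (≤-<-trans (m≤n+m N M) M+N<p)) ⟩
      onSmall j p 0ℤ
        ≡⟨ onSmall-0 j p ⟩
      0ℤ
        ∎
      where open ≡-Reasoning
    bounded : ∀ p → Prime p → ℤ.- (+ v p N) ℤ.≤ prefixExponent j N M p
    bounded p _ = onSmall-≥ j p _ (subst (ℤ._≤ + v p M ℤ.- + v p N) (ℤP.+-identityˡ (ℤ.- + v p N))
                                         (ℤP.+-monoˡ-≤ (ℤ.- + v p N) (ℤ.+≤+ z≤n)))
                                  ℤP.neg-≤-pos

  i+[j-i]≡j : ∀ i j → i ℤ.+ (j ℤ.- i) ≡ j
  i+[j-i]≡j i j = begin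
    i ℤ.+ (j ℤ.- i)         ≡⟨ cong (λ x → i ℤ.+ x) (ℤP.+-comm j (ℤ.- i)) ⟩
    i ℤ.+ (ℤ.- i ℤ.+ j)     ≡⟨ ℤP.+-assoc i (ℤ.- i) j ⟨
    (i ℤ.+ ℤ.- i) ℤ.+ j     ≡⟨ cong (ℤ._+ j) (ℤP.+-inverseʳ i) ⟩
    0ℤ ℤ.+ j                ≡⟨ ℤP.+-identityˡ j ⟩
    j                       ∎
    where open ≡-Reasoning

  prefix-valuation : ∀ {j N G K₁ K₂ p} {z : ℕ → ℤ} → Prime p →
                     + v p K₁ ≡ + v p N ℤ.+ prefixExponent j N G p →
                     + v p K₂ ≡ + v p N ℤ.+ z p → (z p ≢ 0ℤ → primeCount p ≤ j) →
                     v p K₁ ≡ v p G ⊎ v p K₁ ≡ v p K₂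
  prefix-valuation {j} {N} {G} {K₁} {K₂} {p} {z} pp v[K₁] v[K₂] z-small = by-size (primeCount p ≤? j)
    where
    open ≡-Reasoning
    by-size : Dec (primeCount p ≤ j) → v p K₁ ≡ v p G ⊎ v p K₁ ≡ v p K₂
    by-size (yes p≤j) = inj₁ (ℤP.+-injective (begin
      + v p K₁
        ≡⟨ v[K₁] ⟩
      + v p N ℤ.+ onSmall j p (+ v p G ℤ.- + v p N)
        ≡⟨ cong (λ x → + v p N ℤ.+ x) (onSmall-small {j} {p} _ (pp , p≤j)) ⟩
      + v p N ℤ.+ (+ v p G ℤ.- + v p N)
        ≡⟨ i+[j-i]≡j (+ v p N) (+ v p G) ⟩
      + v p G
        ∎))
    by-size (no p≰j) = inj₂ (ℤP.+-injective (begin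
      + v p K₁
        ≡⟨ v[K₁] ⟩
      + v p N ℤ.+ onSmall j p (+ v p G ℤ.- + v p N)
        ≡⟨ cong (λ x → + v p N ℤ.+ x) (onSmall-large {j} {p} _ (p≰j ∘ proj₂)) ⟩
      + v p N ℤ.+ 0ℤ
        ≡⟨ cong (λ x → + v p N ℤ.+ x) z≡0 ⟨
      + v p N ℤ.+ z p
        ≡⟨ v[K₂] ⟨
      + v p K₂
        ∎))
      where
      z≡0 : z p ≡ 0ℤ
      z≡0 = decidable-stable (z p ℤ.≟ 0ℤ) (p≰j ∘ z-small)

  prefix-integral : ∀ {j N G} → 0 < N → 0 < G → IntegralMultiple (prefix j N G) N (prefixExponent j N G)
  prefix-integral 0<N 0<G = prodZ*N-integral (prefixExponent-admissible 0<N 0<G) 0<N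

  InT-admissible : ∀ {j N B z} → (∀ p → z p ≢ 0ℤ → Prime p × primeCount p ≤ j × p ≤ B) →
                   (∀ p → Prime p → ℤ.- (+ v p N) ℤ.≤ z p) → Admissible N B z
  InT-admissible {B = B} {z} support ≥-v = record
    { support-prime = λ p zp≢0 → proj₁ (support p zp≢0)
    ; support-≤     = vanishes
    ; ≥-v           = ≥-v
    }
    where
    vanishes : ∀ p → B < p → z p ≡ 0ℤ
    vanishes p B<p = decidable-stable (z p ℤ.≟ 0ℤ) (<⇒≱ B<p ∘ proj₂ ∘ proj₂ ∘ support p)


open import Data.Nat using (ℕ; _≤_; _<_)
open import Data.Nat.Properties using (≤-trans; <⇒≱)
open import Data.Nat.Primality using (Prime)
open import Data.Rational using (ℚ; _*_) renaming (_<_ to _<ℚ_)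
import Data.Rational.Properties as ℚP
open import Data.Product using (_,_; proj₁; proj₂)
open import Data.Sum using (_⊎_)
open import Function using (_∘_)
open import Relation.Binary.PropositionalEquality using (_≡_; _≢_; refl; trans; cong; subst₂)

lemma8 : (n : ℕ) → 7 ≤ n
    → (q c : ℕ) → ENum q c → ρ≥5/log5 q c
    → (N N⁺ : ℕ) → IsSmallestSC q c N → IsLargestSC q c N⁺
    → ℓ N ≤ n → n < ℓ N⁺
    → (G : ℕ) → IsG n G
    → (j : ℕ) → 1 ≤ j
    → (δ₁ δ₂ : ℚ) → InT j N δ₁ → InT j N δ₂ → δ₁ <ℚ δ₂
    → ℓℚ (δ₂ * toℚ N) ≤ ℓℚ (δ₁ * toℚ N)
    → δ₁ ≢ prefix j N G
lemma8 n _ q c _ _ N N⁺ ((0<N , _) , _) _ _ _ G (0<G , ℓG≤n , maxG) j _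
       δ₁ δ₂ _ (z₂ , B₂ , support₂ , ≥-v₂ , refl) δ₁<δ₂ ℓδ₂N≤ℓδ₁N refl =
  let M , 0<M , G<M , ℓM≤ℓG = exchange-improves 0<G K₁>0 K₂>0 K₁<K₂ ℓK₂≤ℓK₁ v[K₁]
  in <⇒≱ G<M (maxG M 0<M (≤-trans ℓM≤ℓG ℓG≤n))
  where
  open IntegralMultiple (prefix-integral {j} 0<N 0<G)
    renaming (value to K₁; value>0 to K₁>0; δN≡value to δ₁N≡K₁; v-value to v[K₁]-prefix)
  open IntegralMultiple (prodZ*N-integral (InT-admissible support₂ ≥-v₂) 0<N)
    renaming (value to K₂; value>0 to K₂>0; δN≡value to δ₂N≡K₂; v-value to v[K₂]-N)
  K₁<K₂ : K₁ < K₂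
  K₁<K₂ = toℚ-cancel-< (subst₂ _<ℚ_ δ₁N≡K₁ δ₂N≡K₂ (ℚP.*-monoˡ-<-pos (toℚ N) {{toℚ>0 0<N}} δ₁<δ₂))
  ℓK₂≤ℓK₁ : ℓ K₂ ≤ ℓ K₁
  ℓK₂≤ℓK₁ = subst₂ _≤_ (trans (cong ℓℚ δ₂N≡K₂) (ℓℚ-toℚ K₂)) (trans (cong ℓℚ δ₁N≡K₁) (ℓℚ-toℚ K₁))
                     ℓδ₂N≤ℓδ₁N
  v[K₁] : ∀ p → Prime p → v p K₁ ≡ v p G ⊎ v p K₁ ≡ v p K₂
  v[K₁] p pp = prefix-valuation {j} {N} {G} {K₁} {K₂} {p} {z₂} pp
                 (v[K₁]-prefix p pp) (v[K₂]-N p pp) (proj₁ ∘ proj₂ ∘ support₂ p)
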